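{- Let $n>8$ be a positive integer with $8\| n$ (i.e. $8\mid n$ and $16\nmid n$). Then $n$ is neither near superperfect nor deficient superperfect.
   Context: $\sigma(m)$ denotes the sum of the positive divisors of $m$. A positive integer $n$ is near superperfect if $2n+d=\sigma(\sigma(n))$ for some positive divisor $d$ of $n$, and deficient superperfect if $2n-d=\sigma(\sigma(n))$ for some positive divisor $d$ of $n$. -}

module Defs where

open import Data.Nat using (ℕ; suc; _+_; _*_; _∸_; _≤_)
open import Data.Nat.Divisibility using (_∣_; _∣?_)
open import Data.List using (List; filter; upTo; map)
open import Data.Nat.ListAction using (sum)
open import Data.Product using (∃-syntax; _×_)
open import Relation.Binary.PropositionalEquality using (_≡_)

-- σ m = sum of the positive divisors of m (divisors d with 1 ≤ d ≤ m, d ∣ m).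
-- upTo m = [0, …, m-1], so map suc (upTo m) = [1, …, m].
σ : ℕ → ℕ
σ m = sum (filter (_∣? m) (map suc (upTo m)))

NearSuperperfect : ℕ → Set
NearSuperperfect n = ∃[ d ] (d ∣ n × 1 ≤ d × 2 * n + d ≡ σ (σ n))

-- n is deficient superperfect: 2n - d = σ(σ(n)) for some positive divisor d of n
-- (d ∣ n and d ≥ 1 with n ≥ 1 give d ≤ n < 2n, so truncated subtraction is exact)
DeficientSuperperfect : ℕ → Set
DeficientSuperperfect n = ∃[ d ] (d ∣ n × 1 ≤ d × 2 * n ∸ d ≡ σ (σ n))

{-# OPTIONS --safe #-}
module Submission where

open import Defs

open import Data.List using ([]; _∷_; filter; upTo; map; _++_; [_])
open import Data.List.Properties using (map-++; upTo-∷ʳ)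
open import Data.Nat using (ℕ; zero; suc; _+_; _*_; _^_; _∸_; _≤_; _<_; z≤n; s≤s; NonZero)
open import Data.Nat.Coprimality using (Coprime; coprime-divisor)
open import Data.Nat.Divisibility
  using (_∣_; _∤_; _∣?_; divides; ∣-trans; ∣-refl; 1∣_; 0∣⇒≡0; ∣⇒≤; >⇒∤; m∣m*n; ∣n⇒∣m*n;
         *-monoʳ-∣; *-monoˡ-∣; *-cancelˡ-∣)
open import Data.Nat.ListAction using (sum)
open import Data.Nat.ListAction.Properties using (sum-++)
open import Data.Nat.Properties
open import Algebra.Properties.CommutativeSemigroup +-commutativeSemigroup using (interchange)
open import Data.Nat.Tactic.RingSolver using (solve-∀)
open import Data.Product using (_×_; _,_)
open import Data.Sum using (inj₁; inj₂)
open import Function using (_∘_)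
open import Relation.Nullary using (¬_; yes; no; contradiction)
open import Relation.Binary.PropositionalEquality
  using (_≡_; refl; sym; trans; cong; cong₂; module ≡-Reasoning)

-- Write n = 8q with q odd and q > 1.  The odd divisors of 2N are those of N and the even ones
-- are twice the divisors of N, so σ(2N) = σₒ(N) + 2σ(N) with σₒ the sum of odd divisors; hence
-- σ(8q) = 15σ(q).  Since a divisor d of m gives the divisor kd of km, σ(km) ≥ kσ(m), and so
-- σ(σ(n)) ≥ σ(15)σ(q) = 24σ(q) ≥ 24(q + 1) = 3n + 24, while 2n ± d ≤ 3n for every divisor d of n.

variable
  f h : ℕ → ℕ
  m n : ℕ

sumTo : ℕ → (ℕ → ℕ) → ℕ
sumTo zero    f = 0
sumTo (suc n) f = sumTo n f + f (suc n)

sumTo-cong : (∀ d → f d ≡ h d) → ∀ n → sumTo n f ≡ sumTo n h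
sumTo-cong f≡h zero    = refl
sumTo-cong f≡h (suc n) = cong₂ _+_ (sumTo-cong f≡h n) (f≡h (suc n))

sumTo-+ : ∀ n → sumTo n (λ d → f d + h d) ≡ sumTo n f + sumTo n h
sumTo-+         zero    = refl
sumTo-+ {f} {h} (suc n) =
  trans (cong (_+ (f (suc n) + h (suc n))) (sumTo-+ n)) (interchange (sumTo n f) (sumTo n h) _ _)

sumTo-*ˡ : ∀ c n → sumTo n (λ d → c * f d) ≡ c * sumTo n f
sumTo-*ˡ     c zero    = sym (*-zeroʳ c)
sumTo-*ˡ {f} c (suc n) =
  trans (cong (_+ c * f (suc n)) (sumTo-*ˡ c n)) (sym (*-distribˡ-+ c (sumTo n f) (f (suc n))))

sumTo-monoˡ-≤ : m ≤ n → sumTo m f ≤ sumTo n f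
sumTo-monoˡ-≤ {n = zero}  z≤n = ≤-refl
sumTo-monoˡ-≤ {n = suc n} m≤1+n with m≤n⇒m<n∨m≡n m≤1+n
... | inj₁ (s≤s m≤n) = ≤-trans (sumTo-monoˡ-≤ m≤n) (m≤m+n _ _)
... | inj₂ refl      = ≤-refl

sumTo-step : m < n → sumTo m f + f n ≤ sumTo n f
sumTo-step {n = suc n} {f = f} (s≤s m≤n) = +-monoˡ-≤ (f (suc n)) (sumTo-monoˡ-≤ m≤n)

sumTo-vanishing-tail : (∀ d → n < d → f d ≡ 0) → ∀ k → sumTo (k + n) f ≡ sumTo n f
sumTo-vanishing-tail         f≡0 zero    = refl
sumTo-vanishing-tail {n} {f} f≡0 (suc k) = begin
  sumTo (k + n) f + f (suc (k + n)) ≡⟨ cong₂ _+_ (sumTo-vanishing-tail f≡0 k) (f≡0 _ (s≤s (m≤n+m n k))) ⟩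
  sumTo n f + 0                     ≡⟨ +-identityʳ _ ⟩
  sumTo n f                         ∎
  where open ≡-Reasoning

sumTo-evens : (∀ e → f (suc (2 * e)) ≡ 0) → ∀ n → sumTo (2 * n) f ≡ sumTo n (f ∘ (2 *_))
sumTo-evens     f≡0 zero    = refl
sumTo-evens {f} f≡0 (suc n) = begin
  sumTo (2 * suc n) f
    ≡⟨ cong (λ k → sumTo k f) (*-suc 2 n) ⟩
  sumTo (2 * n) f + f (suc (2 * n)) + f (2 + 2 * n)
    ≡⟨ cong (_+ f (2 + 2 * n)) (cong₂ _+_ (sumTo-evens f≡0 n) (f≡0 n)) ⟩
  sumTo n (f ∘ (2 *_)) + 0 + f (2 + 2 * n)
    ≡⟨ cong₂ _+_ (+-identityʳ _) (cong f (sym (*-suc 2 n))) ⟩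
  sumTo n (f ∘ (2 *_)) + f (2 * suc n)
    ∎
  where open ≡-Reasoning

sumTo-dilate-≤ : ∀ k .{{_ : NonZero k}} n → sumTo n (f ∘ (k *_)) ≤ sumTo (k * n) f
sumTo-dilate-≤     k zero    = z≤n
sumTo-dilate-≤ {f} k (suc n) =
  ≤-trans (+-monoˡ-≤ (f (k * suc n)) (sumTo-dilate-≤ k n)) (sumTo-step (*-monoʳ-< k (n<1+n n)))

divisorTerm : ℕ → ℕ → ℕ
divisorTerm N d with d ∣? N
... | yes _ = d
... | no  _ = 0

sum-filter-∣ : ∀ N xs → sum (filter (_∣? N) xs) ≡ sum (map (divisorTerm N) xs)
sum-filter-∣ N []       = refl
sum-filter-∣ N (x ∷ xs) with x ∣? N
... | yes _ = cong (x +_) (sum-filter-∣ N xs)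
... | no  _ = sum-filter-∣ N xs

sum-map-upTo : ∀ n → sum (map f (map suc (upTo n))) ≡ sumTo n f
sum-map-upTo     zero    = refl
sum-map-upTo {f} (suc n) = begin
  sum (map f (map suc (upTo (suc n))))             ≡⟨ cong (sum ∘ map f ∘ map suc) (upTo-∷ʳ n) ⟨
  sum (map f (map suc (upTo n ++ [ n ])))          ≡⟨ cong (sum ∘ map f) (map-++ suc (upTo n) [ n ]) ⟩
  sum (map f (map suc (upTo n) ++ [ suc n ]))      ≡⟨ cong sum (map-++ f (map suc (upTo n)) [ suc n ]) ⟩
  sum (map f (map suc (upTo n)) ++ [ f (suc n) ])  ≡⟨ sum-++ (map f (map suc (upTo n))) [ f (suc n) ] ⟩
  sum (map f (map suc (upTo n))) + (f (suc n) + 0) ≡⟨ cong₂ _+_ (sum-map-upTo n) (+-identityʳ _) ⟩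
  sumTo n f + f (suc n)                            ∎
  where open ≡-Reasoning

σ≡sumTo-divisorTerm : ∀ N → σ N ≡ sumTo N (divisorTerm N)
σ≡sumTo-divisorTerm N = trans (sum-filter-∣ N (map suc (upTo N))) (sum-map-upTo N)

divisorTerm-∣ : ∀ {N d} → d ∣ N → divisorTerm N d ≡ d
divisorTerm-∣ {N} {d} d∣N with d ∣? N
... | yes _   = refl
... | no  d∤N = contradiction d∣N d∤N

divisorTerm-> : ∀ {N d} .{{_ : NonZero N}} → N < d → divisorTerm N d ≡ 0
divisorTerm-> {N} {d} N<d with d ∣? N
... | yes d∣N = contradiction d∣N (>⇒∤ N<d)
... | no  _   = refl

divisorTerm-* : ∀ k .{{_ : NonZero k}} N e → divisorTerm (k * N) (k * e) ≡ k * divisorTerm N e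
divisorTerm-* k N e with k * e ∣? k * N | e ∣? N
... | yes _     | yes _   = refl
... | yes ke∣kN | no  e∤N = contradiction (*-cancelˡ-∣ k ke∣kN) e∤N
... | no  ke∤kN | yes e∣N = contradiction (*-monoʳ-∣ k e∣N) ke∤kN
... | no  _     | no  _   = sym (*-zeroʳ k)

2∤1+2*n : ∀ n → 2 ∤ suc (2 * n)
2∤1+2*n n (divides q 1+2n≡q*2) = even≢odd q n (trans (*-comm 2 q) (sym 1+2n≡q*2))

2∤⇒coprime-2 : ∀ {d} → 2 ∤ d → Coprime d 2
2∤⇒coprime-2 2∤d {zero}                (_   , 0∣2) = contradiction (0∣⇒≡0 0∣2) λ ()
2∤⇒coprime-2 2∤d {suc zero}            _           = refl
2∤⇒coprime-2 2∤d {suc (suc zero)}      (2∣d , _)   = contradiction 2∣d 2∤d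
2∤⇒coprime-2 2∤d {suc (suc (suc i))}   (_   , i∣2) with ∣⇒≤ i∣2
... | s≤s (s≤s ())

oddPart : (ℕ → ℕ) → ℕ → ℕ
oddPart f d with 2 ∣? d
... | yes _ = 0
... | no  _ = f d

evenPart : (ℕ → ℕ) → ℕ → ℕ
evenPart f d with 2 ∣? d
... | yes _ = f d
... | no  _ = 0

oddPart+evenPart : ∀ f d → oddPart f d + evenPart f d ≡ f d
oddPart+evenPart f d with 2 ∣? d
... | yes _ = refl
... | no  _ = +-identityʳ (f d)

oddPart-zero : ∀ f d → f d ≡ 0 → oddPart f d ≡ 0
oddPart-zero f d fd≡0 with 2 ∣? d
... | yes _ = refl
... | no  _ = fd≡0

evenPart-odd : ∀ f e → evenPart f (suc (2 * e)) ≡ 0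
evenPart-odd f e with 2 ∣? suc (2 * e)
... | yes 2∣1+2e = contradiction 2∣1+2e (2∤1+2*n e)
... | no  _      = refl

evenPart-even : ∀ f e → evenPart f (2 * e) ≡ f (2 * e)
evenPart-even f e with 2 ∣? 2 * e
... | yes _   = refl
... | no  2∤2e = contradiction (m∣m*n e) 2∤2e

oddPart-divisorTerm-2* : ∀ N d → oddPart (divisorTerm (2 * N)) d ≡ oddPart (divisorTerm N) d
oddPart-divisorTerm-2* N d with 2 ∣? d
... | yes _   = refl
... | no  2∤d with d ∣? 2 * N | d ∣? N
...   | yes _      | yes _   = refl
...   | yes d∣2N   | no  d∤N = contradiction (coprime-divisor (2∤⇒coprime-2 2∤d) d∣2N) d∤N
...   | no  d∤2N   | yes d∣N = contradiction (∣n⇒∣m*n 2 d∣N) d∤2N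
...   | no  _      | no  _   = refl

oddPart-divisorTerm-odd : 2 ∤ m → ∀ d → oddPart (divisorTerm m) d ≡ divisorTerm m d
oddPart-divisorTerm-odd {m} 2∤m d with 2 ∣? d
... | no  _   = refl
... | yes 2∣d with d ∣? m
...   | yes d∣m = contradiction (∣-trans 2∣d d∣m) 2∤m
...   | no  _   = refl

σₒ : ℕ → ℕ
σₒ N = sumTo N (oddPart (divisorTerm N))

σ-2* : ∀ N → σ (2 * N) ≡ σₒ (2 * N) + 2 * σ N
σ-2* N = begin
  σ (2 * N)                                        ≡⟨ σ≡sumTo-divisorTerm (2 * N) ⟩
  sumTo (2 * N) t                                  ≡⟨ sumTo-cong (sym ∘ oddPart+evenPart t) (2 * N) ⟩
  sumTo (2 * N) (λ d → oddPart t d + evenPart t d) ≡⟨ sumTo-+ (2 * N) ⟩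
  σₒ (2 * N) + sumTo (2 * N) (evenPart t)          ≡⟨ cong (σₒ (2 * N) +_) even-divisors ⟩
  σₒ (2 * N) + 2 * σ N                             ∎
  where
  open ≡-Reasoning
  t : ℕ → ℕ
  t = divisorTerm (2 * N)
  even-divisors : sumTo (2 * N) (evenPart t) ≡ 2 * σ N
  even-divisors = begin
    sumTo (2 * N) (evenPart t)           ≡⟨ sumTo-evens (evenPart-odd t) N ⟩
    sumTo N (evenPart t ∘ (2 *_))        ≡⟨ sumTo-cong (λ e → trans (evenPart-even t e) (divisorTerm-* 2 N e)) N ⟩
    sumTo N (λ e → 2 * divisorTerm N e)  ≡⟨ sumTo-*ˡ 2 N ⟩
    2 * sumTo N (divisorTerm N)          ≡⟨ cong (2 *_) (σ≡sumTo-divisorTerm N) ⟨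
    2 * σ N                              ∎

σₒ-2* : ∀ N → σₒ (2 * N) ≡ σₒ N
σₒ-2* zero      = refl
σₒ-2* N@(suc _) = begin
  sumTo (2 * N) (oddPart (divisorTerm (2 * N)))
    ≡⟨ sumTo-cong (oddPart-divisorTerm-2* N) (2 * N) ⟩
  sumTo (2 * N) (oddPart (divisorTerm N))
    ≡⟨ cong (λ k → sumTo (N + k) (oddPart (divisorTerm N))) (+-identityʳ N) ⟩
  sumTo (N + N) (oddPart (divisorTerm N))
    ≡⟨ sumTo-vanishing-tail (λ d N<d → oddPart-zero (divisorTerm N) d (divisorTerm-> N<d)) N ⟩
  sumTo N (oddPart (divisorTerm N))
    ∎
  where open ≡-Reasoning

σₒ-2^k* : ∀ k m → σₒ (2 ^ k * m) ≡ σₒ m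
σₒ-2^k* zero    m = cong σₒ (*-identityˡ m)
σₒ-2^k* (suc k) m = trans (cong σₒ (*-assoc 2 (2 ^ k) m)) (trans (σₒ-2* (2 ^ k * m)) (σₒ-2^k* k m))

σₒ-odd : 2 ∤ m → σₒ m ≡ σ m
σₒ-odd {m} 2∤m = trans (sumTo-cong (oddPart-divisorTerm-odd 2∤m) m) (sym (σ≡sumTo-divisorTerm m))

σ-2^k*odd : 2 ∤ m → ∀ k → σ (2 ^ k * m) + σ m ≡ 2 ^ suc k * σ m
σ-2^k*odd {m} 2∤m zero    = cong₂ _+_ (cong σ (*-identityˡ m)) (sym (+-identityʳ (σ m)))
σ-2^k*odd {m} 2∤m (suc k) = begin
  σ (2 ^ suc k * m) + σ m                 ≡⟨ cong (λ x → σ x + σ m) (*-assoc 2 (2 ^ k) m) ⟩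
  σ (2 * (2 ^ k * m)) + σ m               ≡⟨ cong (_+ σ m) (σ-2* (2 ^ k * m)) ⟩
  σₒ (2 * (2 ^ k * m)) + 2 * σ (2 ^ k * m) + σ m
                                          ≡⟨ cong (λ x → x + 2 * σ (2 ^ k * m) + σ m) odd-divisors ⟩
  σ m + 2 * σ (2 ^ k * m) + σ m           ≡⟨ regroup (σ m) (σ (2 ^ k * m)) ⟩
  2 * (σ (2 ^ k * m) + σ m)               ≡⟨ cong (2 *_) (σ-2^k*odd 2∤m k) ⟩
  2 * (2 ^ suc k * σ m)                   ≡⟨ *-assoc 2 (2 ^ suc k) (σ m) ⟨
  2 ^ suc (suc k) * σ m                   ∎
  where
  open ≡-Reasoning
  odd-divisors : σₒ (2 * (2 ^ k * m)) ≡ σ m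
  odd-divisors = trans (σₒ-2* (2 ^ k * m)) (trans (σₒ-2^k* k m) (σₒ-odd 2∤m))
  regroup : ∀ a b → a + 2 * b + a ≡ 2 * (b + a)
  regroup = solve-∀

σ-odd*8 : 2 ∤ m → σ (m * 8) ≡ 15 * σ m
σ-odd*8 {m} 2∤m = +-cancelʳ-≡ (σ m) (σ (m * 8)) (15 * σ m) (begin
  σ (m * 8) + σ m     ≡⟨ cong (λ x → σ x + σ m) (*-comm m 8) ⟩
  σ (2 ^ 3 * m) + σ m ≡⟨ σ-2^k*odd 2∤m 3 ⟩
  16 * σ m            ≡⟨ +-comm (σ m) (15 * σ m) ⟩
  15 * σ m + σ m      ∎)
  where open ≡-Reasoning

*-σ-≤-σ-* : ∀ k m → k * σ m ≤ σ (k * m)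
*-σ-≤-σ-* zero      m = z≤n
*-σ-≤-σ-* k@(suc _) m = begin
  k * σ m                                  ≡⟨ cong (k *_) (σ≡sumTo-divisorTerm m) ⟩
  k * sumTo m (divisorTerm m)              ≡⟨ sumTo-*ˡ k m ⟨
  sumTo m (λ e → k * divisorTerm m e)      ≡⟨ sumTo-cong (divisorTerm-* k m) m ⟨
  sumTo m (divisorTerm (k * m) ∘ (k *_))   ≤⟨ sumTo-dilate-≤ k m ⟩
  sumTo (k * m) (divisorTerm (k * m))      ≡⟨ σ≡sumTo-divisorTerm (k * m) ⟨
  σ (k * m)                                ∎
  where open ≤-Reasoning

n<σn : 1 < n → n < σ n
n<σn {n} 1<n = begin
  1 + n                                      ≡⟨ cong₂ _+_ (divisorTerm-∣ (1∣ n)) (divisorTerm-∣ ∣-refl) ⟨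
  sumTo 1 (divisorTerm n) + divisorTerm n n  ≤⟨ sumTo-step 1<n ⟩
  sumTo n (divisorTerm n)                    ≡⟨ σ≡sumTo-divisorTerm n ⟨
  σ n                                        ∎
  where open ≤-Reasoning

3n<σσn-of-odd*8 : ∀ {q} → 2 ∤ q → 1 < q → 3 * (q * 8) < σ (σ (q * 8))
3n<σσn-of-odd*8 {q} 2∤q 1<q = begin-strict
  3 * (q * 8)        ≡⟨ *-comm 3 (q * 8) ⟩
  q * 8 * 3          ≡⟨ *-assoc q 8 3 ⟩
  q * 24             ≡⟨ *-comm q 24 ⟩
  24 * q             <⟨ *-monoʳ-< 24 (n<1+n q) ⟩
  24 * suc q         ≤⟨ *-monoʳ-≤ 24 (n<σn 1<q) ⟩
  24 * σ q           ≡⟨ *-comm 24 (σ q) ⟩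
  σ q * σ 15         ≤⟨ *-σ-≤-σ-* (σ q) 15 ⟩
  σ (σ q * 15)       ≡⟨ cong σ (*-comm (σ q) 15) ⟩
  σ (15 * σ q)       ≡⟨ cong σ (σ-odd*8 2∤q) ⟨
  σ (σ (q * 8))      ∎
  where open ≤-Reasoning

3n<σσn⇒¬NearSuperperfect : ∀ n → 3 * n < σ (σ n) → ¬ NearSuperperfect n
3n<σσn⇒¬NearSuperperfect zero ()
3n<σσn⇒¬NearSuperperfect n@(suc _) 3n<σσn (d , d∣n , _ , 2n+d≡σσn) = <⇒≱ 3n<σσn (begin
  σ (σ n)    ≡⟨ 2n+d≡σσn ⟨
  2 * n + d  ≤⟨ +-monoʳ-≤ (2 * n) (∣⇒≤ d∣n) ⟩
  2 * n + n  ≡⟨ +-comm (2 * n) n ⟩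
  3 * n      ∎)
  where open ≤-Reasoning

3n<σσn⇒¬DeficientSuperperfect : ∀ n → 3 * n < σ (σ n) → ¬ DeficientSuperperfect n
3n<σσn⇒¬DeficientSuperperfect n 3n<σσn (d , _ , _ , 2n∸d≡σσn) = <⇒≱ 3n<σσn (begin
  σ (σ n)    ≡⟨ 2n∸d≡σσn ⟨
  2 * n ∸ d  ≤⟨ m∸n≤m (2 * n) d ⟩
  2 * n      ≤⟨ m≤n+m (2 * n) n ⟩
  3 * n      ∎)
  where open ≤-Reasoning

mainTheorem14 : (n : ℕ) → 8 < n → 8 ∣ n → ¬ (16 ∣ n) →
    ¬ NearSuperperfect n × ¬ DeficientSuperperfect n
mainTheorem14 .(q * 8) 8<n (divides q refl) 16∤n =
  3n<σσn⇒¬NearSuperperfect (q * 8) 3n<σσn , 3n<σσn⇒¬DeficientSuperperfect (q * 8) 3n<σσn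
  where
  3n<σσn : 3 * (q * 8) < σ (σ (q * 8))
  3n<σσn = 3n<σσn-of-odd*8 (λ 2∣q → 16∤n (*-monoˡ-∣ 8 2∣q)) (*-cancelʳ-< 8 1 q 8<n)
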